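{- Let $n\ge 2$ and $0\le t\le n-2$ be integers and consider the flag-shaped minimum blocker $B_n(n-1,t)$ of all $n\times n$ $123$-avoiding permutation matrices. Then for every position $(i,n)$ with $n-t+1\le i\le n$ (the $t\times 1$ block of adjacent positions in column $n$ containing $(n,n)$), there is no $n\times n$ $123$-avoiding permutation matrix $P$ with a $1$ in position $(i,n)$ that intersects $B_n(n-1,t)$ exactly once (i.e. has exactly one $1$ in a position of $B_n(n-1,t)$).
   Context: A permutation matrix $P$ contains a $123$-pattern if $I_3$ is a submatrix of $P$; otherwise $P$ is $123$-avoiding. A set of positions is a blocker if every $n\times n$ $123$-avoiding permutation matrix has a $1$ in one of its positions, and it is minimum if removing any element makes it no longer a blocker. For integers $1\le m\le n$, $0\le t\le m-1$, the flag-shaped blocker $B_n(m,t)$ is the union of $\{(i,m): 1\le i\le n-t\}$ and $\{(i,j): 1\le i\le n-m+1,\ m-t\le j\le m-1\}$, positions written as (row, column); it is a minimum blocker. -}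

module Defs where

open import Data.Nat using (ℕ; suc; _+_; _∸_; _≤_; _<_)
open import Data.Fin using (Fin; toℕ)
open import Data.Fin.Permutation using (Permutation′; _⟨$⟩ʳ_)
open import Data.Product using (_×_; ∃-syntax)
open import Data.Sum using (_⊎_)
open import Relation.Binary.PropositionalEquality using (_≡_)
open import Relation.Nullary using (¬_)

-- Convention: an n×n permutation matrix is given by a permutation σ of Fin n;
-- it has a 1 exactly in the positions (r , σ r).  Rows/columns are 1-based in
-- the paper: row index of r : Fin n is  toℕ r + 1.

row : ∀ {n} → Fin n → ℕ
row r = suc (toℕ r)

col : ∀ {n} → Permutation′ n → Fin n → ℕ
col σ r = suc (toℕ (σ ⟨$⟩ʳ r))

Contains123 : ∀ {n} → Permutation′ n → Set
Contains123 {n} σ =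
  ∃[ a ] ∃[ b ] ∃[ c ] (toℕ a < toℕ b × toℕ b < toℕ c ×
    col σ a < col σ b × col σ b < col σ c)

Avoids123 : ∀ {n} → Permutation′ n → Set
Avoids123 σ = ¬ Contains123 σ

FlagBlocker : (n m t : ℕ) → ℕ → ℕ → Set
FlagBlocker n m t i j =
  (1 ≤ i × i ≤ n ∸ t × j ≡ m)
  ⊎ (1 ≤ i × i ≤ n ∸ m + 1 × m ∸ t ≤ j × j ≤ m ∸ 1)

HasOneAt : ∀ {n} → Permutation′ n → ℕ → ℕ → Set
HasOneAt σ i j = ∃[ r ] (row r ≡ i × col σ r ≡ j)

MeetsExactlyOnce : ∀ {n} → (ℕ → ℕ → Set) → Permutation′ n → Set
MeetsExactlyOnce S σ =
  ∃[ r ] (S (row r) (col σ r) × (∀ r′ → S (row r′) (col σ r′) → r′ ≡ r))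

{-# OPTIONS --safe #-}
module Submission where

-- Let the 1 in column n sit in row r₀ ≥ n − t + 1 ≥ 3. Every row above r₀ has
-- its 1 left of column n, so avoiding 123 forces the columns of rows 1, …, r₀ − 1
-- to decrease strictly. Hence row 2 has column at least r₀ − 2 ≥ (n − 1) − t,
-- row 1 a larger column, and row 1's column is at most n − 1. So both 1s of the
-- top two rows lie in B_n(n − 1, t): row 2 in the arm, row 1 in the arm or on
-- the pole, contradicting that P meets the blocker exactly once.

open import Defs
open import Data.Nat using (ℕ; zero; suc; _+_; _∸_; _≤_; _<_; z≤n; s≤s; s≤s⁻¹; z<s)
open import Data.Nat.Properties
open import Data.Fin using (Fin; zero; suc; toℕ; fromℕ<)
open import Data.Fin.Properties using (toℕ-injective; toℕ<n; toℕ-fromℕ<)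
open import Data.Fin.Permutation using (Permutation′; _⟨$⟩ʳ_; _⟨$⟩ˡ_; inverseˡ)
open import Data.Product using (_×_; ∃-syntax; _,_)
open import Data.Sum using (inj₁; inj₂)
open import Relation.Nullary using (¬_)
open import Relation.Binary.PropositionalEquality
open import Relation.Binary.Definitions using (tri<; tri≈; tri>)
open import Data.Empty using (⊥-elim)

col-injective : ∀ {n} (P : Permutation′ n) {x y : Fin n} → col P x ≡ col P y → x ≡ y
col-injective P {x} {y} eq = begin
  x                 ≡⟨ inverseˡ P ⟨
  P ⟨$⟩ˡ (P ⟨$⟩ʳ x) ≡⟨ cong (P ⟨$⟩ˡ_) (toℕ-injective (suc-injective eq)) ⟩
  P ⟨$⟩ˡ (P ⟨$⟩ʳ y) ≡⟨ inverseˡ P ⟩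
  y                 ∎
  where open ≡-Reasoning

col≤n : ∀ {n} (P : Permutation′ n) (x : Fin n) → col P x ≤ n
col≤n P x = toℕ<n (P ⟨$⟩ʳ x)

avoids123⇒descent : ∀ {n} {P : Permutation′ n} → Avoids123 P → {x y z : Fin n} →
  toℕ x < toℕ y → toℕ y < toℕ z → col P y < col P z → col P y < col P x
avoids123⇒descent {P = P} avoids {x} {y} {z} x<y y<z cy<cz with <-cmp (col P x) (col P y)
... | tri< cx<cy _ _ = ⊥-elim (avoids (x , y , z , x<y , y<z , cx<cy , cy<cz))
... | tri≈ _ cx≡cy _ = ⊥-elim (<⇒≢ x<y (cong toℕ (col-injective P cx≡cy)))
... | tri> _ _ cy<cx = cy<cx

col<n-off-last-column : ∀ {n} (P : Permutation′ n) {x z : Fin n} → col P z ≡ n → x ≢ z → col P x < n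
col<n-off-last-column P cz≡n x≢z =
  ≤∧≢⇒< (col≤n P _) λ cx≡n → x≢z (col-injective P (trans cx≡n (sym cz≡n)))

avoids123⇒descent-above-last-column : ∀ {n} {P : Permutation′ n} → Avoids123 P →
  {z : Fin n} → col P z ≡ n → ∀ x y → toℕ x < toℕ y → toℕ y < toℕ z →
  col P y < col P x
avoids123⇒descent-above-last-column {P = P} avoids {z} cz≡n x y x<y y<z =
  avoids123⇒descent {P = P} avoids {x} {y} {z} x<y y<z
    (subst (col P y <_) (sym cz≡n) (col<n-off-last-column P cz≡n λ y≡z → <⇒≢ y<z (cong toℕ y≡z)))

decreasing⇒≥distance : ∀ {n} (f : Fin n → ℕ) (b : Fin n) →
  (∀ x y → toℕ x < toℕ y → toℕ y < toℕ b → f y < f x) →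
  ∀ d x → toℕ x + d < toℕ b → d ≤ f x
decreasing⇒≥distance f b decreasing zero    x _       = z≤n
decreasing⇒≥distance {n} f b decreasing (suc d) x x+sd<b =
  ≤-<-trans (decreasing⇒≥distance f b decreasing d y y+d<b) (decreasing x y x<y y<b)
  where
  x+sd≡sx+d : toℕ x + suc d ≡ suc (toℕ x + d)
  x+sd≡sx+d = +-suc (toℕ x) d
  sx<b : suc (toℕ x) < toℕ b
  sx<b = ≤-<-trans (subst (suc (toℕ x) ≤_) (sym x+sd≡sx+d) (s≤s (m≤m+n (toℕ x) d))) x+sd<b
  sx<n : suc (toℕ x) < n
  sx<n = <-trans sx<b (toℕ<n b)
  y : Fin n
  y = fromℕ< sx<n
  toℕy≡sx : toℕ y ≡ suc (toℕ x)
  toℕy≡sx = toℕ-fromℕ< sx<n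
  x<y : toℕ x < toℕ y
  x<y = subst (toℕ x <_) (sym toℕy≡sx) ≤-refl
  y<b : toℕ y < toℕ b
  y<b = subst (_< toℕ b) (sym toℕy≡sx) sx<b
  y+d<b : toℕ y + d < toℕ b
  y+d<b = subst (λ m → m + d < toℕ b) (sym toℕy≡sx) (subst (_< toℕ b) x+sd≡sx+d x+sd<b)

flag-arm : ∀ {n m t i j} → 1 ≤ i → i ≤ n ∸ m + 1 → m ∸ t ≤ j → j < m → FlagBlocker n m t i j
flag-arm 1≤i i≤ m∸t≤j j<m = inj₂ (1≤i , i≤ , m∸t≤j , <⇒≤pred j<m)

flag-arm-or-pole : ∀ {n m t i j} → 1 ≤ i → i ≤ n ∸ m + 1 → i ≤ n ∸ t →
  m ∸ t ≤ j → j ≤ m → FlagBlocker n m t i j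
flag-arm-or-pole {t = t} 1≤i i≤ i≤n∸t m∸t≤j j≤m with m≤n⇒m<n∨m≡n j≤m
... | inj₁ j<m = flag-arm {t = t} 1≤i i≤ m∸t≤j j<m
... | inj₂ j≡m = inj₁ (1≤i , i≤n∸t , j≡m)

below-second-row : ∀ {m d} (r : Fin (suc (suc m))) → suc (suc d) ≤ toℕ r →
  ∃[ r₁ ] (r ≡ suc (suc r₁) × d ≤ toℕ r₁)
below-second-row (suc (suc r₁)) (s≤s (s≤s d≤r₁)) = r₁ , refl , d≤r₁

pole-row-below-top-rows : ∀ {k t} (r₀ : Fin (suc (suc k))) → t ≤ k → suc (suc k) ∸ t + 1 ≤ row r₀ →
  ∃[ r ] (r₀ ≡ suc (suc r) × suc k ∸ t ≤ suc (toℕ r))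
pole-row-below-top-rows {k} {t} r₀ t≤k lo =
  let (r , r₀≡ , k∸t≤r) = below-second-row r₀ (s≤s⁻¹ (subst (_≤ row r₀) lo≡ lo))
  in r , r₀≡ , subst (_≤ suc (toℕ r)) (sym (+-∸-assoc 1 t≤k)) (s≤s k∸t≤r)
  where
  lo≡ : suc (suc k) ∸ t + 1 ≡ suc (suc (suc (k ∸ t)))
  lo≡ = trans (cong (_+ 1) (+-∸-assoc 2 t≤k)) (+-comm (suc (suc (k ∸ t))) 1)

top-rows-columns : ∀ {k} {P : Permutation′ (suc (suc k))} → Avoids123 P →
  (r : Fin k) → col P (suc (suc r)) ≡ suc (suc k) →
  suc (toℕ r) ≤ col P (suc zero) × col P (suc zero) < col P zero × col P zero ≤ suc k
top-rows-columns {k} {P} avoids r cr≡n = second-high , second<first , first≤m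
  where
  descent : ∀ x y → toℕ x < toℕ y → toℕ y < suc (suc (toℕ r)) → col P y < col P x
  descent = avoids123⇒descent-above-last-column {P = P} avoids cr≡n
  second-high : suc (toℕ r) ≤ col P (suc zero)
  second-high = s≤s (decreasing⇒≥distance (λ x → toℕ (P ⟨$⟩ʳ x)) (suc (suc r))
    (λ x y x<y y<b → s≤s⁻¹ (descent x y x<y y<b)) (toℕ r) (suc zero) ≤-refl)
  second<first : col P (suc zero) < col P zero
  second<first = descent zero (suc zero) z<s (s≤s z<s)
  first≤m : col P zero ≤ suc k
  first≤m = s≤s⁻¹ (col<n-off-last-column P cr≡n λ ())

flag-top-rows : ∀ {k t j₁ j₂} → t ≤ k → suc k ∸ t ≤ j₂ → j₂ < j₁ → j₁ ≤ suc k →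
  FlagBlocker (suc (suc k)) (suc k) t 1 j₁ × FlagBlocker (suc (suc k)) (suc k) t 2 j₂
flag-top-rows {k} {t} t≤k low j₂<j₁ j₁≤m =
  flag-arm-or-pole {t = t} (s≤s z≤n) (≤-trans (s≤s z≤n) arm-rows)
    (subst (1 ≤_) (sym (+-∸-assoc 2 t≤k)) (s≤s z≤n)) (≤-trans low (<⇒≤ j₂<j₁)) j₁≤m
  , flag-arm {suc (suc k)} {suc k} {t} (s≤s z≤n) arm-rows low (<-≤-trans j₂<j₁ j₁≤m)
  where
  arm-rows : 2 ≤ suc (suc k) ∸ suc k + 1
  arm-rows = subst (2 ≤_) (cong (_+ 1) (sym (m+n∸n≡m 1 k))) ≤-refl

lemma4p1 : (n t : ℕ) → 2 ≤ n → t ≤ n ∸ 2 →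
    (i : ℕ) → n ∸ t + 1 ≤ i → i ≤ n →
    ¬ (∃[ P ] (Avoids123 {n} P × HasOneAt P i n ×
          MeetsExactlyOnce (FlagBlocker n (n ∸ 1) t) P))
lemma4p1 (suc (suc k)) t (s≤s (s≤s _)) t≤k _ lo _
  (P , avoids , (r₀ , refl , cr₀≡n) , (_ , _ , meets-once))
  with pole-row-below-top-rows r₀ t≤k lo
... | r , refl , low
  with top-rows-columns {P = P} avoids r cr₀≡n
... | second-high , second<first , first≤m
  with flag-top-rows t≤k (≤-trans low second-high) second<first first≤m
... | first∈B , second∈B
  with trans (meets-once zero first∈B) (sym (meets-once (suc zero) second∈B))
... | ()
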